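{- Let $\Gamma$ be a graph with adjacency matrix $A$ and let $N\geqslant 3$. Let $D_N=\langle r,s \mid r^N, s^2, (rs)^2\rangle$ act on the set of closed $N$-walks of $\Gamma$ as described below, and for $g\in D_N$ let $\operatorname{fix}_\Gamma(g)$ be the set of closed $N$-walks fixed by $g$. Then (i) $|\operatorname{fix}_\Gamma(r^k)|=\operatorname{tr}(A^{\gcd(k,N)})$ for all $k\in\mathbb Z$; (ii) $|\operatorname{fix}_\Gamma(r^{2k}s)|=0$ for all $k\in\mathbb Z$; (iii) for all $k\in\mathbb Z$, $|\operatorname{fix}_\Gamma(r^{2k+1}s)|=\mathbf 1^\top A^{N/2}\mathbf 1$ if $N$ is even, and $=0$ if $N$ is odd.
   Context: Graphs are simple (no loops, no multiple edges). A closed $N$-walk of $\Gamma$ is a sequence $\mathbf x=x_0x_1\dots x_{N-1}$ of vertices with $x_i$ adjacent to $x_{i+1}$ for every $i\in\{0,\dots,N-1\}$, indices taken modulo $N$. The positions $0,\dots,N-1$ are identified with the vertices of a regular $N$-gon, and $D_N$ acts on positions by $r: i\mapsto i+1$ and $s: i\mapsto -1-i$ (mod $N$); a walk $\mathbf x$ is fixed by $g\in D_N$ if $x_{g(i)}=x_i$ for all $i$. $\mathbf 1$ denotes the all-ones vector. -}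

module Defs where

open import Data.Nat using (ℕ; zero; suc; _+_; _*_)
import Data.Fin as Fin
open import Data.Integer using (ℤ; +_; -[1+_]; _%ℕ_) renaming (_+_ to _+ℤ_)
open import Data.Integer.DivMod using (n%ℕd<d)
open import Data.Fin using (Fin; toℕ; fromℕ<)
open import Data.Fin.Properties using (all?; _≟_)
open import Data.Bool using (Bool; true; false; T; if_then_else_)
open import Data.Vec using (Vec; []; _∷_; lookup)
open import Data.List using (List; []; _∷_; length; filter; concatMap; map; allFin)
open import Data.Product using (_×_)
open import Relation.Nullary.Decidable using (Dec; does; T?; _×-dec_)
open import Relation.Binary.PropositionalEquality using (_≡_)
open import Function using (_∘_)

record Graph (n : ℕ) : Set where
  field
    adj     : Fin n → Fin n → Bool
    symm    : ∀ i j → adj i j ≡ adj j i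
    irrefl  : ∀ i → adj i i ≡ false
open Graph public

Matrix : ℕ → Set
Matrix n = Fin n → Fin n → ℕ

∑ : ∀ {n} → (Fin n → ℕ) → ℕ
∑ {zero}  f = 0
∑ {suc n} f = f Fin.zero + ∑ (λ i → f (Fin.suc i))

_⊗_ : ∀ {n} → Matrix n → Matrix n → Matrix n
(M ⊗ P) i j = ∑ (λ k → M i k * P k j)

identity : ∀ {n} → Matrix n
identity i j = if does (i ≟ j) then 1 else 0

_^ᴹ_ : ∀ {n} → Matrix n → ℕ → Matrix n
M ^ᴹ zero  = identity
M ^ᴹ suc m = M ⊗ (M ^ᴹ m)

tr : ∀ {n} → Matrix n → ℕ
tr M = ∑ (λ i → M i i)

onesForm : ∀ {n} → Matrix n → ℕ
onesForm M = ∑ (λ i → ∑ (λ j → M i j))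

adjMatrix : ∀ {n} → Graph n → Matrix n
adjMatrix G i j = if adj G i j then 1 else 0

-- Positions 0,…,N-1 of the N-gon, i.e. ℤ/N, as Fin N.

posℤ : ∀ {N} → ℤ → Fin (suc N) 
posℤ {N} z = fromℕ< (n%ℕd<d z (suc N))

rPow : ∀ {N} → ℤ → Fin N → Fin N
rPow {zero}  k ()
rPow {suc N} k i = posℤ (+ toℕ i +ℤ k)

sRefl : ∀ {N} → Fin N → Fin N
sRefl {zero}  ()
sRefl {suc N} i = posℤ (-[1+ toℕ i ])

nextPos : ∀ {N} → Fin N → Fin N
nextPos = rPow (+ 1)

IsClosedWalk : ∀ {n N} → Graph n → Vec (Fin n) N → Set
IsClosedWalk G x = ∀ i → T (adj G (lookup x i) (lookup x (nextPos i)))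

FixedBy : ∀ {n N} → (Fin N → Fin N) → Vec (Fin n) N → Set
FixedBy g x = ∀ i → lookup x (g i) ≡ lookup x i

isClosedWalk? : ∀ {n N} (G : Graph n) (x : Vec (Fin n) N) → Dec (IsClosedWalk G x)
isClosedWalk? G x = all? (λ i → T? (adj G (lookup x i) (lookup x (nextPos i))))

fixedBy? : ∀ {n N} (g : Fin N → Fin N) (x : Vec (Fin n) N) → Dec (FixedBy g x)
fixedBy? g x = all? (λ i → lookup x (g i) ≟ lookup x i)

allVecs : (n N : ℕ) → List (Vec (Fin n) N)
allVecs n zero    = [] ∷ []
allVecs n (suc N) = concatMap (λ v → map (_∷ v) (allFin n)) (allVecs n N)

fixCount : ∀ {n} (G : Graph n) (N : ℕ) → (Fin N → Fin N) → ℕ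
fixCount {n} G N g =
  length (filter (λ x → isClosedWalk? G x ×-dec fixedBy? g x) (allVecs n N))

-- Each count is turned, by an explicit bijection, into a count of walks that a matrix entry
-- computes: (A^(k+1))_ab counts the sequences a v₁ … v_k b that are walks, so tr A^d counts
-- closed d-walks and 1ᵀ A^h 1 counts walks with h + 1 vertices. A closed N-walk x is read as
-- the N-periodic function z ↦ x_(z mod N) on ℤ. If r^k fixes x, this function also has period
-- k, hence period gcd(k, N) by Bézout, so x is a closed gcd(k, N)-walk repeated N / gcd(k, N)
-- times. If r^c s fixes x then x(c − 1 − z) = x(z). For c = 2k this puts the equal vertices
-- x(k − 1) = x(k) next to each other, a loop; so does z = k + (N − 1)/2 when c = 2k + 1 and N
-- is odd. When c = 2k + 1 and N = 2h, x is symmetric about position k and is determined by the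
-- walk x_k … x_(k+h), which can be arbitrary: the whole of x is recovered by folding the
-- 2h-cycle onto the path 0, 1, …, h.

module Submission where

open import Defs
open import Data.Nat using (ℕ; _≤_; _/_)
open import Data.Nat.GCD using (gcd)
open import Data.Nat.Divisibility using (_∣_)
open import Data.Integer using (ℤ; +_; ∣_∣) renaming (_+_ to _+ℤ_; _*_ to _*ℤ_)
open import Data.Product using (_×_)
open import Relation.Nullary using (¬_)
open import Relation.Binary.PropositionalEquality using (_≡_)
open import Function using (_∘_)

open import Data.Nat using (zero; suc; _+_; _*_; _∸_; _<_; z≤n; s≤s; _≤?_; _<?_)
import Data.Nat as ℕ
open import Data.Nat.Properties
  using ( suc-injective; +-comm; +-identityʳ; *-comm; *-identityʳ; *-zeroʳ; *-distribˡ-+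
        ; +-commutativeSemigroup; m+n≡0⇒m≡0; m+n≡0⇒n≡0; m+n∸n≡m; m∸n+n≡m
        ; ≤-reflexive; ≤-trans; ≤-antisym; ≤-pred; ≤-<-trans; <⇒≤; <⇒≱; ≰⇒>; ≮⇒≥; ≤∧≢⇒<
        ; n≤1+n; m≤m+n; m≤n+m; +-mono-<-≤; ∸-monoʳ-≤ )
open import Algebra.Properties.CommutativeSemigroup +-commutativeSemigroup using (interchange)
open import Data.Nat.DivMod using (_%_; m%n<n; m≡m%n+[m/n]*n; m*n/n≡m)
open import Data.Nat.Divisibility using (divides)
open import Data.Nat.GCD using (gcd-GCD; gcd[m,n]∣m; gcd[m,n]∣n; gcd[m,n]≡0⇒n≡0; module Bézout)
open import Data.Nat.ListAction using (sum)
open import Data.Nat.ListAction.Properties using (sum-++)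
open import Data.Integer using (-[1+_]; -_; _/ℕ_)
import Data.Integer.Properties as ℤ
open import Data.Integer.DivMod using (a≡a%ℕn+[a/ℕn]*n)
open import Data.Integer.Tactic.RingSolver using (solve-∀)
open import Data.Bool using (Bool; true; false; if_then_else_; _∧_; T; T?)
open import Data.Bool.Properties using (T-∧; ∧-assoc)
open import Data.Unit using (tt)
open import Data.Empty using (⊥; ⊥-elim)
open import Data.Product using (_,_; proj₁; proj₂)
open import Data.Sum using (_⊎_; inj₁; inj₂)
open import Data.Fin using (Fin; zero; suc; toℕ; inject₁; fromℕ; fromℕ<)
open import Data.Fin.Properties using (_≟_; toℕ-injective; toℕ<n; toℕ-fromℕ<; toℕ-fromℕ; toℕ-inject₁)
open import Data.Vec using (Vec; []; _∷_; lookup; head)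
import Data.Vec as Vec
open import Data.Vec.Properties using (≡-dec; lookup∘tabulate; tabulate∘lookup; tabulate-cong)
open import Data.List using (List; []; _∷_; _++_; length; filter; map; concatMap; allFin; tabulate)
open import Data.List.Properties using (map-++; map-∘; map-cong; map-tabulate)
open import Function using (_⇔_; mk⇔; Equivalence)
open import Relation.Nullary using (yes; no; does)
open import Relation.Nullary.Decidable using (_×-dec_; does-⇔; dec-false)
open import Relation.Unary using (Pred; Decidable)
open import Relation.Binary.Definitions using (DecidableEquality)
open import Relation.Binary.PropositionalEquality
  using (_≢_; refl; sym; trans; cong; cong₂; subst; subst₂; module ≡-Reasoning)

-- Finite sums and counting

𝟙 : Bool → ℕ
𝟙 b = if b then 1 else 0

𝟙-∧ : ∀ x y → 𝟙 (x ∧ y) ≡ 𝟙 x * 𝟙 y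
𝟙-∧ true  y = sym (+-identityʳ (𝟙 y))
𝟙-∧ false y = refl

∑-cong : ∀ {n} {f g : Fin n → ℕ} → (∀ i → f i ≡ g i) → ∑ f ≡ ∑ g
∑-cong {zero}  f≗g = refl
∑-cong {suc n} f≗g = cong₂ _+_ (f≗g zero) (∑-cong (f≗g ∘ suc))

∑-zero : ∀ n → ∑ {n} (λ _ → 0) ≡ 0
∑-zero zero    = refl
∑-zero (suc n) = ∑-zero n

∑-distrib-+ : ∀ {n} (f g : Fin n → ℕ) → ∑ (λ i → f i + g i) ≡ ∑ f + ∑ g
∑-distrib-+ {zero}  f g = refl
∑-distrib-+ {suc n} f g =
  trans (cong (_+_ (f zero + g zero)) (∑-distrib-+ (f ∘ suc) (g ∘ suc)))
        (interchange (f zero) (g zero) _ _)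

∑-distribˡ-* : ∀ {n} c (f : Fin n → ℕ) → ∑ (λ i → c * f i) ≡ c * ∑ f
∑-distribˡ-* {zero}  c f = sym (*-zeroʳ c)
∑-distribˡ-* {suc n} c f =
  trans (cong (_+_ (c * f zero)) (∑-distribˡ-* c (f ∘ suc))) (sym (*-distribˡ-+ c (f zero) _))

∑-comm : ∀ {m n} (f : Fin m → Fin n → ℕ) → ∑ (λ i → ∑ (f i)) ≡ ∑ (λ j → ∑ (λ i → f i j))
∑-comm {zero}  {n} f = sym (∑-zero n)
∑-comm {suc m}     f = trans (cong (_+_ (∑ (f zero))) (∑-comm (f ∘ suc))) (sym (∑-distrib-+ (f zero) _))

∑-δ : ∀ {n} (j : Fin n) (f : Fin n → ℕ) → ∑ (λ i → 𝟙 (does (i ≟ j)) * f i) ≡ f j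
∑-δ {suc n} zero    f = trans (cong₂ _+_ (+-identityʳ (f zero)) (∑-zero n)) (+-identityʳ _)
∑-δ {suc n} (suc j) f = ∑-δ j (f ∘ suc)

_≟ᵛ_ : ∀ {n N} → DecidableEquality (Vec (Fin n) N)
_≟ᵛ_ = ≡-dec _≟_

∑ⱽ : ∀ {n} N → (Vec (Fin n) N → ℕ) → ℕ
∑ⱽ zero    f = f []
∑ⱽ (suc N) f = ∑ (λ a → ∑ⱽ N (λ v → f (a ∷ v)))

module _ {n : ℕ} where

  ∑ⱽ-cong : ∀ N {f g : Vec (Fin n) N → ℕ} → (∀ v → f v ≡ g v) → ∑ⱽ N f ≡ ∑ⱽ N g
  ∑ⱽ-cong zero    f≗g = f≗g []
  ∑ⱽ-cong (suc N) f≗g = ∑-cong (λ a → ∑ⱽ-cong N (λ v → f≗g (a ∷ v)))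

  ∑ⱽ-zero : ∀ N → ∑ⱽ {n} N (λ _ → 0) ≡ 0
  ∑ⱽ-zero zero    = refl
  ∑ⱽ-zero (suc N) = trans (∑-cong {n} (λ _ → ∑ⱽ-zero N)) (∑-zero n)

  ∑ⱽ-distribˡ-* : ∀ N c (f : Vec (Fin n) N → ℕ) → ∑ⱽ N (λ v → c * f v) ≡ c * ∑ⱽ N f
  ∑ⱽ-distribˡ-* zero    c f = refl
  ∑ⱽ-distribˡ-* (suc N) c f =
    trans (∑-cong {n} (λ a → ∑ⱽ-distribˡ-* N c (λ v → f (a ∷ v)))) (∑-distribˡ-* {n} c _)

  ∑ⱽ-∑-comm : ∀ {m} N (f : Vec (Fin n) N → Fin m → ℕ) →
    ∑ⱽ N (λ v → ∑ (f v)) ≡ ∑ (λ j → ∑ⱽ N (λ v → f v j))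
  ∑ⱽ-∑-comm zero    f = refl
  ∑ⱽ-∑-comm (suc N) f =
    trans (∑-cong (λ a → ∑ⱽ-∑-comm N (λ v → f (a ∷ v)))) (∑-comm (λ a j → ∑ⱽ N (λ v → f (a ∷ v) j)))

  ∑ⱽ-comm : ∀ N K (f : Vec (Fin n) N → Vec (Fin n) K → ℕ) →
    ∑ⱽ N (λ x → ∑ⱽ K (f x)) ≡ ∑ⱽ K (λ y → ∑ⱽ N (λ x → f x y))
  ∑ⱽ-comm zero    K f = refl
  ∑ⱽ-comm (suc N) K f =
    trans (∑-cong (λ a → ∑ⱽ-comm N K (λ v → f (a ∷ v)))) (sym (∑ⱽ-∑-comm K (λ y a → ∑ⱽ N (λ v → f (a ∷ v) y))))

  ∑ⱽ-δ : ∀ N (y : Vec (Fin n) N) → ∑ⱽ N (λ x → 𝟙 (does (x ≟ᵛ y))) ≡ 1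
  ∑ⱽ-δ zero    []      = refl
  ∑ⱽ-δ (suc N) (b ∷ y) = begin
    ∑ (λ a → ∑ⱽ N (λ v → 𝟙 (does (a ≟ b) ∧ does (v ≟ᵛ y))))
      ≡⟨ ∑-cong (λ a → ∑ⱽ-cong N (λ v → 𝟙-∧ (does (a ≟ b)) _)) ⟩
    ∑ (λ a → ∑ⱽ N (λ v → 𝟙 (does (a ≟ b)) * 𝟙 (does (v ≟ᵛ y))))
      ≡⟨ ∑-cong (λ a → ∑ⱽ-distribˡ-* N (𝟙 (does (a ≟ b))) _) ⟩
    ∑ (λ a → 𝟙 (does (a ≟ b)) * ∑ⱽ N (λ v → 𝟙 (does (v ≟ᵛ y))))
      ≡⟨ ∑-δ b _ ⟩
    ∑ⱽ N (λ v → 𝟙 (does (v ≟ᵛ y)))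
      ≡⟨ ∑ⱽ-δ N y ⟩
    1 ∎
    where open ≡-Reasoning

  count : ∀ {N p} {P : Pred (Vec (Fin n) N) p} → Decidable P → ℕ
  count {N} P? = ∑ⱽ N (λ x → 𝟙 (does (P? x)))

length-filter : ∀ {a p} {A : Set a} {P : Pred A p} (P? : Decidable P) xs →
  length (filter P? xs) ≡ sum (map (λ x → 𝟙 (does (P? x))) xs)
length-filter P? []       = refl
length-filter P? (x ∷ xs) with does (P? x)
... | true  = cong suc (length-filter P? xs)
... | false = length-filter P? xs

sum-tabulate : ∀ {n} (f : Fin n → ℕ) → sum (tabulate f) ≡ ∑ f
sum-tabulate {zero}  f = refl
sum-tabulate {suc n} f = cong (_+_ (f zero)) (sum-tabulate (f ∘ suc))

sum-map-allFin : ∀ {n} (f : Fin n → ℕ) → sum (map f (allFin n)) ≡ ∑ f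
sum-map-allFin {n} f = trans (cong sum (map-tabulate {n = n} (λ i → i) f)) (sum-tabulate f)

sum-map-concatMap : ∀ {a b} {A : Set a} {B : Set b} (h : B → ℕ) (g : A → List B) xs →
  sum (map h (concatMap g xs)) ≡ sum (map (λ x → sum (map h (g x))) xs)
sum-map-concatMap h g []       = refl
sum-map-concatMap h g (x ∷ xs) = begin
  sum (map h (g x ++ concatMap g xs))                  ≡⟨ cong sum (map-++ h (g x) _) ⟩
  sum (map h (g x) ++ map h (concatMap g xs))          ≡⟨ sum-++ (map h (g x)) _ ⟩
  sum (map h (g x)) + sum (map h (concatMap g xs))     ≡⟨ cong (_+_ (sum (map h (g x)))) (sum-map-concatMap h g xs) ⟩
  sum (map h (g x)) + sum (map (λ x → sum (map h (g x))) xs) ∎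
  where open ≡-Reasoning

sum-map-∑ : ∀ {a n} {A : Set a} (f : A → Fin n → ℕ) xs →
  sum (map (λ x → ∑ (f x)) xs) ≡ ∑ (λ i → sum (map (λ x → f x i) xs))
sum-map-∑ {n = n} f []       = sym (∑-zero n)
sum-map-∑         f (x ∷ xs) = trans (cong (_+_ (∑ (f x))) (sum-map-∑ f xs)) (sym (∑-distrib-+ (f x) _))

sum-map-allVecs : ∀ {n} N (h : Vec (Fin n) N → ℕ) → sum (map h (allVecs n N)) ≡ ∑ⱽ N h
sum-map-allVecs         zero    h = +-identityʳ (h [])
sum-map-allVecs {n = n} (suc N) h = begin
  sum (map h (concatMap (λ v → map (_∷ v) (allFin n)) (allVecs n N)))
    ≡⟨ sum-map-concatMap h (λ v → map (_∷ v) (allFin n)) (allVecs n N) ⟩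
  sum (map (λ v → sum (map h (map (_∷ v) (allFin n)))) (allVecs n N))
    ≡⟨ cong sum (map-cong (λ v → trans (cong sum (sym (map-∘ (allFin n)))) (sum-map-allFin (λ a → h (a ∷ v))))
                          (allVecs n N)) ⟩
  sum (map (λ v → ∑ (λ a → h (a ∷ v))) (allVecs n N))
    ≡⟨ sum-map-∑ (λ v a → h (a ∷ v)) (allVecs n N) ⟩
  ∑ (λ a → sum (map (λ v → h (a ∷ v)) (allVecs n N)))
    ≡⟨ ∑-cong (λ a → sum-map-allVecs N (λ v → h (a ∷ v))) ⟩
  ∑ⱽ (suc N) h ∎
  where open ≡-Reasoning

length-filter-allVecs : ∀ {n N p} {P : Pred (Vec (Fin n) N) p} (P? : Decidable P) →
  length (filter P? (allVecs n N)) ≡ count P?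
length-filter-allVecs {n} {N} P? = trans (length-filter P? (allVecs n N)) (sum-map-allVecs N _)

module _ {n : ℕ} where

  count-empty : ∀ {N p} {P : Pred (Vec (Fin n) N) p} (P? : Decidable P) → (∀ x → ¬ P x) → count P? ≡ 0
  count-empty {N} P? none = trans (∑ⱽ-cong N (λ x → cong 𝟙 (dec-false (P? x) (none x)))) (∑ⱽ-zero N)

  count-bijection : ∀ {N K p q} {P : Pred (Vec (Fin n) N) p} {Q : Pred (Vec (Fin n) K) q}
    (P? : Decidable P) (Q? : Decidable Q)
    (f : Vec (Fin n) N → Vec (Fin n) K) (g : Vec (Fin n) K → Vec (Fin n) N) →
    (∀ x → P x → Q (f x)) → (∀ y → Q y → P (g y)) →
    (∀ x → P x → g (f x) ≡ x) → (∀ y → Q y → f (g y) ≡ y) →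
    count P? ≡ count Q?
  count-bijection {N} {K} {P = P} {Q} P? Q? f g f-P→Q g-Q→P g∘f f∘g = begin
    ∑ⱽ N (λ x → [P] x)
      ≡⟨ ∑ⱽ-cong N (λ x → sym (trans (cong (_*_ ([P] x)) (∑ⱽ-δ K (f x))) (*-identityʳ _))) ⟩
    ∑ⱽ N (λ x → [P] x * ∑ⱽ K (λ y → 𝟙 (does (y ≟ᵛ f x))))
      ≡⟨ ∑ⱽ-cong N (λ x → sym (∑ⱽ-distribˡ-* K ([P] x) _)) ⟩
    ∑ⱽ N (λ x → ∑ⱽ K (λ y → [P] x * 𝟙 (does (y ≟ᵛ f x))))
      ≡⟨ ∑ⱽ-cong N (λ x → ∑ⱽ-cong K (λ y → sym (𝟙-∧ (does (P? x)) _))) ⟩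
    ∑ⱽ N (λ x → ∑ⱽ K (λ y → 𝟙 (does (P? x ×-dec (y ≟ᵛ f x)))))
      ≡⟨ ∑ⱽ-comm N K _ ⟩
    ∑ⱽ K (λ y → ∑ⱽ N (λ x → 𝟙 (does (P? x ×-dec (y ≟ᵛ f x)))))
      ≡⟨ ∑ⱽ-cong K column ⟩
    ∑ⱽ K (λ y → 𝟙 (does (Q? y))) ∎
    where
    open ≡-Reasoning
    [P] : Vec (Fin n) N → ℕ
    [P] x = 𝟙 (does (P? x))

    column : ∀ y → ∑ⱽ N (λ x → 𝟙 (does (P? x ×-dec (y ≟ᵛ f x)))) ≡ 𝟙 (does (Q? y))
    column y with Q? y
    ... | yes qy = trans (∑ⱽ-cong N (λ x → cong 𝟙 (does-⇔ (mk⇔ to from) (P? x ×-dec (y ≟ᵛ f x)) (x ≟ᵛ g y))))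
                         (∑ⱽ-δ N (g y))
      where
      to : ∀ {x} → P x × y ≡ f x → x ≡ g y
      to (px , y≡fx) = trans (sym (g∘f _ px)) (cong g (sym y≡fx))
      from : ∀ {x} → x ≡ g y → P x × y ≡ f x
      from refl = g-Q→P y qy , sym (f∘g y qy)
    ... | no ¬qy = trans (∑ⱽ-cong N (λ x → cong 𝟙 (dec-false (P? x ×-dec (y ≟ᵛ f x)) (unhit x)))) (∑ⱽ-zero N)
      where
      unhit : ∀ x → ¬ (P x × y ≡ f x)
      unhit x (px , y≡fx) = ¬qy (subst Q (sym y≡fx) (f-P→Q x px))

-- Walks and powers of the adjacency matrix

module _ {n} (G : Graph n) where

  isWalk : ∀ {k} → Vec (Fin n) (suc k) → Bool
  isWalk (a ∷ [])    = true
  isWalk (a ∷ b ∷ v) = adj G a b ∧ isWalk (b ∷ v)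

  isWalkTo : ∀ {k} → Vec (Fin n) (suc k) → Fin n → Bool
  isWalkTo {k} u b = isWalk u ∧ adj G (lookup u (fromℕ k)) b

  private
    A : Matrix n
    A = adjMatrix G

    𝟙-adj-∧ : ∀ a b x → A a b * 𝟙 x ≡ 𝟙 (adj G a b ∧ x)
    𝟙-adj-∧ a b x = sym (𝟙-∧ (adj G a b) x)

  ^ᴹ-suc≡walks : ∀ k a b → (A ^ᴹ suc k) a b ≡ ∑ⱽ k (λ v → 𝟙 (isWalkTo (a ∷ v) b))
  ^ᴹ-suc≡walks zero    a b = trans (∑-cong (λ j → *-comm (A a j) _)) (∑-δ b (A a))
  ^ᴹ-suc≡walks (suc k) a b = begin
    ∑ (λ j → A a j * (A ^ᴹ suc k) j b)
      ≡⟨ ∑-cong (λ j → cong (_*_ (A a j)) (^ᴹ-suc≡walks k j b)) ⟩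
    ∑ (λ j → A a j * ∑ⱽ k (λ v → 𝟙 (isWalkTo (j ∷ v) b)))
      ≡⟨ ∑-cong (λ j → sym (∑ⱽ-distribˡ-* k (A a j) _)) ⟩
    ∑ (λ j → ∑ⱽ k (λ v → A a j * 𝟙 (isWalkTo (j ∷ v) b)))
      ≡⟨ ∑-cong (λ j → ∑ⱽ-cong k (λ v → trans (𝟙-adj-∧ a j _) (cong 𝟙 (sym (∧-assoc (adj G a j) _ _))))) ⟩
    ∑ⱽ (suc k) (λ v → 𝟙 (isWalkTo (a ∷ v) b)) ∎
    where open ≡-Reasoning

  row-sum-^ᴹ≡walks : ∀ k a → ∑ (λ b → (A ^ᴹ k) a b) ≡ ∑ⱽ k (λ v → 𝟙 (isWalk (a ∷ v)))
  row-sum-^ᴹ≡walks zero    a =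
    trans (∑-cong (λ b → trans (cong 𝟙 (does-⇔ (mk⇔ sym sym) (a ≟ b) (b ≟ a))) (sym (*-identityʳ _))))
          (∑-δ a (λ _ → 1))
  row-sum-^ᴹ≡walks (suc k) a = begin
    ∑ (λ b → ∑ (λ j → A a j * (A ^ᴹ k) j b))
      ≡⟨ ∑-comm (λ b j → A a j * (A ^ᴹ k) j b) ⟩
    ∑ (λ j → ∑ (λ b → A a j * (A ^ᴹ k) j b))
      ≡⟨ ∑-cong (λ j → ∑-distribˡ-* {n} (A a j) _) ⟩
    ∑ (λ j → A a j * ∑ (λ b → (A ^ᴹ k) j b))
      ≡⟨ ∑-cong (λ j → cong (_*_ (A a j)) (row-sum-^ᴹ≡walks k j)) ⟩
    ∑ (λ j → A a j * ∑ⱽ k (λ v → 𝟙 (isWalk (j ∷ v))))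
      ≡⟨ ∑-cong (λ j → sym (∑ⱽ-distribˡ-* k (A a j) _)) ⟩
    ∑ (λ j → ∑ⱽ k (λ v → A a j * 𝟙 (isWalk (j ∷ v))))
      ≡⟨ ∑-cong (λ j → ∑ⱽ-cong k (λ v → 𝟙-adj-∧ a j _)) ⟩
    ∑ⱽ (suc k) (λ v → 𝟙 (isWalk (a ∷ v))) ∎
    where open ≡-Reasoning

  tr-^ᴹ-suc≡closedWalks : ∀ k → tr (A ^ᴹ suc k) ≡ ∑ⱽ (suc k) (λ u → 𝟙 (isWalkTo u (head u)))
  tr-^ᴹ-suc≡closedWalks k = ∑-cong (λ a → ^ᴹ-suc≡walks k a a)

  onesForm-^ᴹ≡walks : ∀ k → onesForm (A ^ᴹ k) ≡ ∑ⱽ (suc k) (λ u → 𝟙 (isWalk u))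
  onesForm-^ᴹ≡walks k = ∑-cong (row-sum-^ᴹ≡walks k)

  isWalk⇒adjacent : ∀ {k} (u : Vec (Fin n) (suc k)) → T (isWalk u) →
    ∀ i j → suc (toℕ i) ≡ toℕ j → T (adj G (lookup u i) (lookup u j))
  isWalk⇒adjacent (a ∷ [])    w zero    zero          ()
  isWalk⇒adjacent (a ∷ b ∷ v) w zero    (suc zero)    _ = proj₁ (Equivalence.to (T-∧ {adj G a b}) w)
  isWalk⇒adjacent (a ∷ b ∷ v) w zero    (suc (suc j)) ()
  isWalk⇒adjacent (a ∷ b ∷ v) w (suc i) zero          ()
  isWalk⇒adjacent (a ∷ b ∷ v) w (suc i) (suc j)       e =
    isWalk⇒adjacent (b ∷ v) (proj₂ (Equivalence.to (T-∧ {adj G a b}) w)) i j (suc-injective e)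

  adjacent⇒isWalk : ∀ {k} (u : Vec (Fin n) (suc k)) →
    (∀ j → T (adj G (lookup u (inject₁ j)) (lookup u (suc j)))) → T (isWalk u)
  adjacent⇒isWalk (a ∷ [])    _   = tt
  adjacent⇒isWalk (a ∷ b ∷ v) edge = Equivalence.from T-∧ (edge zero , adjacent⇒isWalk (b ∷ v) (edge ∘ suc))

  IsClosedWalkℤ : (ℤ → Fin n) → Set
  IsClosedWalkℤ F = ∀ z → T (adj G (F z) (F (z +ℤ + 1)))

  isClosedWalkℤ-≗ : ∀ {F F′ : ℤ → Fin n} → (∀ z → F z ≡ F′ z) → IsClosedWalkℤ F → IsClosedWalkℤ F′
  isClosedWalkℤ-≗ F≗F′ closed z = subst₂ (λ a b → T (adj G a b)) (F≗F′ z) (F≗F′ (z +ℤ + 1)) (closed z)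

  isClosedWalkℤ⇒≢-step : ∀ {F : ℤ → Fin n} → IsClosedWalkℤ F → ∀ z → F z ≢ F (z +ℤ + 1)
  isClosedWalkℤ⇒≢-step {F} closed z Fz≡Fz+1 = subst T (trans (cong (adj G (F z)) (sym Fz≡Fz+1)) (irrefl G (F z))) (closed z)

-- Periodic functions on ℤ

module _ {a} {A : Set a} where

  Periodic : (ℤ → A) → ℤ → Set a
  Periodic F t = ∀ z → F (z +ℤ t) ≡ F z

  module _ (F : ℤ → A) where

    periodic-zero : Periodic F (+ 0)
    periodic-zero z = cong F (ℤ.+-identityʳ z)

    periodic-+ : ∀ {t t′} → Periodic F t → Periodic F t′ → Periodic F (t +ℤ t′)
    periodic-+ {t} {t′} pt pt′ z = trans (cong F (sym (ℤ.+-assoc z t t′))) (trans (pt′ (z +ℤ t)) (pt z))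

    periodic-neg : ∀ {t} → Periodic F t → Periodic F (- t)
    periodic-neg {t} pt z = trans (sym (pt (z +ℤ - t))) (cong F (cancel z t))
      where
      cancel : ∀ z t → z +ℤ - t +ℤ t ≡ z
      cancel = solve-∀

    periodic-*⁺ : ∀ {t} → Periodic F t → ∀ q → Periodic F (+ q *ℤ t)
    periodic-*⁺ {t} pt zero    = periodic-zero
    periodic-*⁺ {t} pt (suc q) = subst (Periodic F) (unfold (+ q) t) (periodic-+ pt (periodic-*⁺ pt q))
      where
      unfold : ∀ q t → t +ℤ q *ℤ t ≡ (+ 1 +ℤ q) *ℤ t
      unfold = solve-∀

    periodic-*ℤ : ∀ {t} → Periodic F t → ∀ q → Periodic F (q *ℤ t)
    periodic-*ℤ pt (+ q)        = periodic-*⁺ pt q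
    periodic-*ℤ {t} pt -[1+ q ] = subst (Periodic F) (neg-* (+ suc q) t) (periodic-neg (periodic-*⁺ pt (suc q)))
      where
      neg-* : ∀ q t → - (q *ℤ t) ≡ - q *ℤ t
      neg-* = solve-∀

    periodic-*ℕ : ∀ {t} → Periodic F (+ t) → ∀ q → Periodic F (+ (q * t))
    periodic-*ℕ {t} pt q = subst (Periodic F) (sym (ℤ.pos-* q t)) (periodic-*⁺ pt q)

    periodic-multiple : ∀ {s t} → s ∣ t → Periodic F (+ s) → Periodic F (+ t)
    periodic-multiple (divides q refl) ps = periodic-*ℕ ps q

    periodic-∣∣ : ∀ {t} → Periodic F t → Periodic F (+ ∣ t ∣)
    periodic-∣∣ {+ _}      pt = pt
    periodic-∣∣ { -[1+ _ ]} pt = periodic-neg pt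

    ∣∣-periodic : ∀ {t} → Periodic F (+ ∣ t ∣) → Periodic F t
    ∣∣-periodic {+ _}      pt = pt
    ∣∣-periodic { -[1+ _ ]} pt = periodic-neg pt

    periodic-cancelʳ : ∀ {d t} → Periodic F (+ t) → Periodic F (+ (d + t)) → Periodic F (+ d)
    periodic-cancelʳ {d} {t} pt pdt z = trans (sym (pt (z +ℤ + d))) (trans (cong F (ℤ.+-assoc z (+ d) (+ t))) (pdt z))

    periodic-gcd : ∀ {i j} → Periodic F (+ i) → Periodic F (+ j) → Periodic F (+ gcd i j)
    periodic-gcd {i} {j} pi pj with Bézout.identity (gcd-GCD i j)
    ... | Bézout.+- x y eq = periodic-cancelʳ (periodic-*ℕ pj y) (subst (λ t → Periodic F (+ t)) (sym eq) (periodic-*ℕ pi x))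
    ... | Bézout.-+ x y eq = periodic-cancelʳ (periodic-*ℕ pi x) (subst (λ t → Periodic F (+ t)) (sym eq) (periodic-*ℕ pj y))

    periodic-≗ : ∀ {G : ℤ → A} {t} → (∀ z → F z ≡ G z) → Periodic F t → Periodic G t
    periodic-≗ F≗G pt z = trans (sym (F≗G _)) (trans (pt z) (F≗G z))

-- Residues modulo M, and sequences of length M as M-periodic functions on ℤ

module Modulo (m : ℕ) where

  M : ℕ
  M = suc m

  infix 4 _∼_
  record _∼_ (z z′ : ℤ) : Set where
    constructor quotient
    field
      q  : ℤ
      eq : z′ ≡ z +ℤ q *ℤ + M

  ∼-reflexive : ∀ {z z′} → z ≡ z′ → z ∼ z′
  ∼-reflexive {z} refl = quotient (+ 0) (sym (ℤ.+-identityʳ z))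

  ∼-sym : ∀ {z z′} → z ∼ z′ → z′ ∼ z
  ∼-sym {z} (quotient q e) = quotient (- q) (trans (cancel z q (+ M)) (cong (λ t → t +ℤ - q *ℤ + M) (sym e)))
    where
    cancel : ∀ z q M → z ≡ z +ℤ q *ℤ M +ℤ - q *ℤ M
    cancel = solve-∀

  ∼-trans : ∀ {z z′ z″} → z ∼ z′ → z′ ∼ z″ → z ∼ z″
  ∼-trans {z} (quotient q e) (quotient q′ e′) =
    quotient (q +ℤ q′) (trans e′ (trans (cong (λ t → t +ℤ q′ *ℤ + M) e) (collect z q q′ (+ M))))
    where
    collect : ∀ z q q′ M → z +ℤ q *ℤ M +ℤ q′ *ℤ M ≡ z +ℤ (q +ℤ q′) *ℤ M
    collect = solve-∀

  ∼-+ʳ : ∀ {z z′} w → z ∼ z′ → z +ℤ w ∼ z′ +ℤ w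
  ∼-+ʳ {z} w (quotient q e) = quotient q (trans (cong (_+ℤ w) e) (shuffle z w q (+ M)))
    where
    shuffle : ∀ z w q M → z +ℤ q *ℤ M +ℤ w ≡ z +ℤ w +ℤ q *ℤ M
    shuffle = solve-∀

  ∼-+ˡ : ∀ {z z′} w → z ∼ z′ → w +ℤ z ∼ w +ℤ z′
  ∼-+ˡ {z} w (quotient q e) = quotient q (trans (cong (w +ℤ_) e) (sym (ℤ.+-assoc w z _)))

  ∼-neg : ∀ {z z′} → z ∼ z′ → - z ∼ - z′
  ∼-neg {z} (quotient q e) = quotient (- q) (trans (cong -_ e) (distrib z q (+ M)))
    where
    distrib : ∀ z q M → - (z +ℤ q *ℤ M) ≡ - z +ℤ - q *ℤ M
    distrib = solve-∀

  z∼z+M : ∀ z → z ∼ z +ℤ + M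
  z∼z+M z = quotient (+ 1) (cong (z +ℤ_) (sym (ℤ.*-identityˡ (+ M))))

  private
    ≡+q*M⇒≡ : ∀ {r r′} q → r′ < M → r′ ≡ r + q * M → r ≡ r′
    ≡+q*M⇒≡         zero    _    e = sym (trans e (+-identityʳ _))
    ≡+q*M⇒≡ {r} {r′} (suc q) r′<M e =
      ⊥-elim (<⇒≱ r′<M (subst (M ≤_) (sym e) (≤-trans (m≤m+n M (q * M)) (m≤n+m _ r))))

    unpos : ∀ {r r′} q → + r′ ≡ + r +ℤ + q *ℤ + M → r′ ≡ r + q * M
    unpos {r} q e = ℤ.+-injective (trans e (cong (+ r +ℤ_) (sym (ℤ.pos-* q M))))

  residue-unique : ∀ {r r′} → r < M → r′ < M → + r ∼ + r′ → r ≡ r′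
  residue-unique _   r′<M   (quotient (+ q) e)     = ≡+q*M⇒≡ q r′<M (unpos q e)
  residue-unique r<M _    c@(quotient -[1+ q ] _) = sym (≡+q*M⇒≡ (suc q) r<M (unpos (suc q) (_∼_.eq (∼-sym c))))

  toℕ-posℤ∼ : ∀ z → + toℕ (posℤ {m} z) ∼ z
  toℕ-posℤ∼ z = quotient (z /ℕ M)
    (trans (a≡a%ℕn+[a/ℕn]*n z M) (cong (λ r → + r +ℤ (z /ℕ M) *ℤ + M) (sym (toℕ-fromℕ< _))))

  posℤ-cong : ∀ {z z′} → z ∼ z′ → posℤ {m} z ≡ posℤ z′
  posℤ-cong {z} {z′} z∼z′ = toℕ-injective (residue-unique (toℕ<n _) (toℕ<n _)
    (∼-trans (toℕ-posℤ∼ z) (∼-trans z∼z′ (∼-sym (toℕ-posℤ∼ z′)))))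

  posℤ-toℕ : ∀ (i : Fin M) → posℤ (+ toℕ i) ≡ i
  posℤ-toℕ i = toℕ-injective (residue-unique (toℕ<n _) (toℕ<n i) (toℕ-posℤ∼ (+ toℕ i)))

  toℕ-posℤ-< : ∀ {j} → j < M → toℕ (posℤ {m} (+ j)) ≡ j
  toℕ-posℤ-< j<M = residue-unique (toℕ<n _) j<M (toℕ-posℤ∼ (+ _))

  module _ {a} {A : Set a} where

    extend : Vec A M → ℤ → A
    extend x z = lookup x (posℤ z)

    extend-cong : ∀ (x : Vec A M) {z z′} → z ∼ z′ → extend x z ≡ extend x z′
    extend-cong x = cong (lookup x) ∘ posℤ-cong

    extend-toℕ : ∀ (x : Vec A M) i → extend x (+ toℕ i) ≡ lookup x i
    extend-toℕ x i = cong (lookup x) (posℤ-toℕ i)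

    extend-injective : ∀ {x y : Vec A M} → (∀ z → extend x z ≡ extend y z) → x ≡ y
    extend-injective {x} {y} x≗y = begin
      x                           ≡⟨ tabulate∘lookup x ⟨
      Vec.tabulate (lookup x)     ≡⟨ tabulate-cong (λ i → trans (sym (extend-toℕ x i))
                                                                (trans (x≗y (+ toℕ i)) (extend-toℕ y i))) ⟩
      Vec.tabulate (lookup y)     ≡⟨ tabulate∘lookup y ⟩
      y                           ∎
      where open ≡-Reasoning

    extend-periodic : ∀ (x : Vec A M) → Periodic (extend x) (+ M)
    extend-periodic x z = sym (extend-cong x (z∼z+M z))

    periodic⇒∼-invariant : ∀ {F : ℤ → A} → Periodic F (+ M) → ∀ {z z′} → z ∼ z′ → F z ≡ F z′
    periodic⇒∼-invariant {F} p (quotient q e) = sym (trans (cong F e) (periodic-*ℤ F p q _))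

    ∀position⇔∀ℤ : ∀ {r} (R : A → A → Set r) {ψ : Fin M → Fin M} {φ : ℤ → ℤ} →
      (∀ {z z′} → z ∼ z′ → φ z ∼ φ z′) → (∀ i → ψ i ≡ posℤ (φ (+ toℕ i))) → (x : Vec A M) →
      (∀ i → R (lookup x i) (lookup x (ψ i))) ⇔ (∀ z → R (extend x z) (extend x (φ z)))
    ∀position⇔∀ℤ R {ψ} {φ} φ-cong ψ≡φ x = mk⇔
      (λ h z → subst (R (extend x z))
                     (trans (cong (lookup x) (ψ≡φ (posℤ z))) (extend-cong x (φ-cong (toℕ-posℤ∼ z))))
                     (h (posℤ z)))
      (λ h i → subst₂ R (extend-toℕ x i) (sym (cong (lookup x) (ψ≡φ i))) (h (+ toℕ i)))

  module _ {n} (x : Vec (Fin n) M) where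

    fixedBy-rPow⇔periodic : ∀ k → FixedBy (rPow k) x ⇔ Periodic (extend x) k
    fixedBy-rPow⇔periodic k = ∀position⇔∀ℤ (λ a b → b ≡ a) (∼-+ʳ k) (λ _ → refl) x

    -- r^c s is i ↦ c − 1 − i, written −(1 + z) + c so that at z = toℕ i it is sRefl's −[1+ i] + c.
    fixedBy-rPow∘sRefl⇔ : ∀ c → FixedBy (rPow c ∘ sRefl) x ⇔ (∀ z → extend x (- (+ 1 +ℤ z) +ℤ c) ≡ extend x z)
    fixedBy-rPow∘sRefl⇔ c = ∀position⇔∀ℤ (λ a b → b ≡ a) (∼-+ʳ c ∘ ∼-neg ∘ ∼-+ˡ (+ 1))
                                        (λ i → posℤ-cong (∼-+ʳ c (toℕ-posℤ∼ -[1+ toℕ i ]))) x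

  toℕ-nextPos : ∀ (i : Fin M) → suc (toℕ i) < M → toℕ (nextPos i) ≡ suc (toℕ i)
  toℕ-nextPos i i+1<M = trans (toℕ-posℤ-< (subst (_< M) (+-comm 1 (toℕ i)) i+1<M)) (+-comm (toℕ i) 1)

  nextPos-inject₁ : ∀ (j : Fin m) → nextPos (inject₁ j) ≡ suc j
  nextPos-inject₁ j = toℕ-injective (trans (toℕ-nextPos (inject₁ j) (s≤s (subst (_< m) (sym (toℕ-inject₁ j)) (toℕ<n j))))
                                           (cong suc (toℕ-inject₁ j)))

  nextPos-last : ∀ (i : Fin M) → toℕ i ≡ m → nextPos i ≡ zero
  nextPos-last i i≡m = trans (posℤ-cong (∼-trans (∼-reflexive (cong +_ (trans (cong (_+ 1) i≡m) (+-comm m 1))))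
                                                 (∼-sym (z∼z+M (+ 0)))))
                             (posℤ-toℕ zero)

  module _ {n} (G : Graph n) where

    isClosedWalk⇔ℤ : ∀ x → IsClosedWalk G x ⇔ IsClosedWalkℤ G (extend x)
    isClosedWalk⇔ℤ = ∀position⇔∀ℤ (λ a b → T (adj G a b)) (∼-+ʳ (+ 1)) (λ _ → refl)

    isClosedWalk⇔isWalkTo : ∀ (x : Vec (Fin n) M) → IsClosedWalk G x ⇔ T (isWalkTo G x (head x))
    isClosedWalk⇔isWalkTo x@(a ∷ _) = mk⇔ to from
      where
      Edge : Fin M → Fin M → Set
      Edge i j = T (adj G (lookup x i) (lookup x j))

      to : IsClosedWalk G x → T (isWalkTo G x a)
      to closed = Equivalence.from T-∧
        ( adjacent⇒isWalk G x (λ j → subst (Edge (inject₁ j)) (nextPos-inject₁ j) (closed (inject₁ j)))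
        , subst (Edge (fromℕ m)) (nextPos-last (fromℕ m) (toℕ-fromℕ m)) (closed (fromℕ m)))

      from : T (isWalkTo G x a) → IsClosedWalk G x
      from w i with Equivalence.to (T-∧ {isWalk G x}) w | m ℕ.≟ toℕ i
      ... | _ , last | yes m≡i =
        subst₂ Edge (toℕ-injective (trans (toℕ-fromℕ m) m≡i)) (sym (nextPos-last i (sym m≡i))) last
      ... | walk , _ | no m≢i =
        isWalk⇒adjacent G x walk i (nextPos i) (sym (toℕ-nextPos i (s≤s (≤∧≢⇒< (≤-pred (toℕ<n i)) (m≢i ∘ sym)))))

    count-closedWalks : count (isClosedWalk? {N = M} G) ≡ tr (adjMatrix G ^ᴹ M)
    count-closedWalks = trans (∑ⱽ-cong M (λ x → cong 𝟙 (does-⇔ (isClosedWalk⇔isWalkTo x) (isClosedWalk? G x) (T? _))))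
                              (sym (tr-^ᴹ-suc≡closedWalks G m))

-- Rotations

module _ {a} {A : Set a} {m d : ℕ} where
  private
    module N = Modulo m
    module D = Modulo d

  resample : Vec A (suc m) → Vec A (suc d)
  resample x = Vec.tabulate (λ i → N.extend x (+ toℕ i))

  extend-resample : ∀ (x : Vec A (suc m)) → Periodic (N.extend x) (+ suc d) →
    ∀ z → D.extend (resample x) z ≡ N.extend x z
  extend-resample x p z = trans (lookup∘tabulate (λ i → N.extend x (+ toℕ i)) (posℤ z))
                                (D.periodic⇒∼-invariant p (D.toℕ-posℤ∼ z))

module _ {n} (G : Graph n) {m d : ℕ} (k : ℤ) (gcd≡ : gcd ∣ k ∣ (suc m) ≡ suc d) where
  private
    module N = Modulo m
    module D = Modulo d

    P : Vec (Fin n) (suc m) → Set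
    P x = IsClosedWalk G x × FixedBy (rPow k) x

    P? : Decidable P
    P? x = isClosedWalk? G x ×-dec fixedBy? (rPow k) x

    downsample : Vec (Fin n) (suc m) → Vec (Fin n) (suc d)
    downsample = resample

    upsample : Vec (Fin n) (suc d) → Vec (Fin n) (suc m)
    upsample = resample

    d∣k : suc d ∣ ∣ k ∣
    d∣k = subst (_∣ ∣ k ∣) gcd≡ (gcd[m,n]∣m ∣ k ∣ (suc m))

    d∣N : suc d ∣ suc m
    d∣N = subst (_∣ suc m) gcd≡ (gcd[m,n]∣n ∣ k ∣ (suc m))

    extend-upsample : ∀ (y : Vec (Fin n) (suc d)) z → N.extend (upsample y) z ≡ D.extend y z
    extend-upsample y = extend-resample y (periodic-multiple (D.extend y) d∣N (D.extend-periodic y))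

    extend-downsample : ∀ (x : Vec (Fin n) (suc m)) → P x → ∀ z → D.extend (downsample x) z ≡ N.extend x z
    extend-downsample x (_ , fixed) = extend-resample x (subst (λ t → Periodic (N.extend x) (+ t)) gcd≡
      (periodic-gcd (N.extend x) (periodic-∣∣ (N.extend x) (Equivalence.to (N.fixedBy-rPow⇔periodic x k) fixed))
                                 (N.extend-periodic x)))

    downsample-closed : ∀ x → P x → IsClosedWalk G (downsample x)
    downsample-closed x px@(closed , _) = Equivalence.from (D.isClosedWalk⇔ℤ G (downsample x))
      (isClosedWalkℤ-≗ G (sym ∘ extend-downsample x px) (Equivalence.to (N.isClosedWalk⇔ℤ G x) closed))

    upsample-P : ∀ y → IsClosedWalk G y → P (upsample y)
    upsample-P y closed =
        Equivalence.from (N.isClosedWalk⇔ℤ G (upsample y))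
          (isClosedWalkℤ-≗ G (sym ∘ extend-upsample y) (Equivalence.to (D.isClosedWalk⇔ℤ G y) closed))
      , Equivalence.from (N.fixedBy-rPow⇔periodic (upsample y) k)
          (periodic-≗ (D.extend y) (sym ∘ extend-upsample y)
            (∣∣-periodic (D.extend y) (periodic-multiple (D.extend y) d∣k (D.extend-periodic y))))

    upsample∘downsample : ∀ x → P x → upsample (downsample x) ≡ x
    upsample∘downsample x px =
      N.extend-injective (λ z → trans (extend-upsample (downsample x) z) (extend-downsample x px z))

    downsample∘upsample : ∀ y → IsClosedWalk G y → downsample (upsample y) ≡ y
    downsample∘upsample y closed =
      D.extend-injective (λ z → trans (extend-downsample (upsample y) (upsample-P y closed) z) (extend-upsample y z))

  fixCount-rᵏ : fixCount G (suc m) (rPow k) ≡ tr (adjMatrix G ^ᴹ suc d)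
  fixCount-rᵏ = begin
    fixCount G (suc m) (rPow k)          ≡⟨ length-filter-allVecs P? ⟩
    count P?                             ≡⟨ count-bijection P? (isClosedWalk? G) downsample upsample
                                              downsample-closed upsample-P upsample∘downsample downsample∘upsample ⟩
    count (isClosedWalk? {N = suc d} G)  ≡⟨ D.count-closedWalks G ⟩
    tr (adjMatrix G ^ᴹ suc d)            ∎
    where open ≡-Reasoning

fixCount-rᵏ-gcd : ∀ {n} (G : Graph n) m k → fixCount G (suc m) (rPow k) ≡ tr (adjMatrix G ^ᴹ gcd ∣ k ∣ (suc m))
fixCount-rᵏ-gcd G m k with gcd ∣ k ∣ (suc m) in gcd≡
... | zero  with () ← gcd[m,n]≡0⇒n≡0 ∣ k ∣ gcd≡
... | suc d = fixCount-rᵏ G k gcd≡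

-- Reflections

module _ {n} (G : Graph n) (m : ℕ) where
  open Modulo m

  fixCount≡0 : ∀ {g} → (∀ x → IsClosedWalk G x → FixedBy g x → ⊥) → fixCount G M g ≡ 0
  fixCount≡0 {g} none = trans (length-filter-allVecs P?) (count-empty P? (λ x (closed , fixed) → none x closed fixed))
    where
    P? : Decidable (λ x → IsClosedWalk G x × FixedBy g x)
    P? x = isClosedWalk? G x ×-dec fixedBy? g x

  fixCount-r²ᵏs : ∀ k → fixCount G M (rPow (+ 2 *ℤ k) ∘ sRefl) ≡ 0
  fixCount-r²ᵏs k = fixCount≡0 (λ x closed fixed →
    isClosedWalkℤ⇒≢-step G (Equivalence.to (isClosedWalk⇔ℤ G x) closed) (k +ℤ - + 1)
      (sym (trans (cong (extend x) (reflect k)) (Equivalence.to (fixedBy-rPow∘sRefl⇔ x (+ 2 *ℤ k)) fixed (k +ℤ - + 1)))))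
    where
    reflect : ∀ k → k +ℤ - + 1 +ℤ + 1 ≡ - (+ 1 +ℤ (k +ℤ - + 1)) +ℤ + 2 *ℤ k
    reflect = solve-∀

  fixCount-r²ᵏ⁺¹s≡0 : ∀ h → M ≡ 1 + 2 * h → ∀ k → fixCount G M (rPow (+ 2 *ℤ k +ℤ + 1) ∘ sRefl) ≡ 0
  fixCount-r²ᵏ⁺¹s≡0 h M≡1+2h k = fixCount≡0 (λ x closed fixed →
    isClosedWalkℤ⇒≢-step G (Equivalence.to (isClosedWalk⇔ℤ G x) closed) (k +ℤ + h) (begin
      extend x (k +ℤ + h)
        ≡⟨ Equivalence.to (fixedBy-rPow∘sRefl⇔ x (+ 2 *ℤ k +ℤ + 1)) fixed (k +ℤ + h) ⟨
      extend x (- (+ 1 +ℤ (k +ℤ + h)) +ℤ (+ 2 *ℤ k +ℤ + 1))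
        ≡⟨ cong (extend x) (reflect k (+ h)) ⟩
      extend x (k +ℤ - + h)
        ≡⟨ extend-cong x (z∼z+M (k +ℤ - + h)) ⟩
      extend x (k +ℤ - + h +ℤ + M)
        ≡⟨ cong (λ t → extend x (k +ℤ - + h +ℤ t)) (trans (cong +_ M≡1+2h) (cong (+ 1 +ℤ_) (ℤ.pos-* 2 h))) ⟩
      extend x (k +ℤ - + h +ℤ (+ 1 +ℤ + 2 *ℤ + h))
        ≡⟨ cong (extend x) (wrap k (+ h)) ⟩
      extend x (k +ℤ + h +ℤ + 1) ∎))
    where
    open ≡-Reasoning
    reflect : ∀ k h → - (+ 1 +ℤ (k +ℤ h)) +ℤ (+ 2 *ℤ k +ℤ + 1) ≡ k +ℤ - h
    reflect = solve-∀
    wrap : ∀ k h → k +ℤ - h +ℤ (+ 1 +ℤ + 2 *ℤ h) ≡ k +ℤ h +ℤ + 1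
    wrap = solve-∀

module Folding (h′ : ℕ) where

  h : ℕ
  h = suc h′

  open Modulo (h′ + h)

  h<M : h < M
  h<M = s≤s (m≤n+m h h′)

  foldℕ : ℕ → ℕ
  foldℕ r with r ≤? h
  ... | yes _ = r
  ... | no  _ = M ∸ r

  -- The distance from z to 0 on the cycle ℤ/2h.
  ‖_‖ : ℤ → ℕ
  ‖ z ‖ = foldℕ (toℕ (posℤ {h′ + h} z))

  infix 4 _±∼_
  _±∼_ : ℕ → ℤ → Set
  t ±∼ z = + t ∼ z ⊎ - + t ∼ z

  foldℕ-spec : ∀ r → r < M → foldℕ r ≤ h × foldℕ r ±∼ + r
  foldℕ-spec r r<M with r ≤? h
  ... | yes r≤h = r≤h , inj₁ (∼-reflexive refl)
  ... | no  r≰h = M∸r≤h , inj₂ (quotient (+ 1) (reflect (M ∸ r) r (m∸n+n≡m (<⇒≤ r<M))))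
    where
    M∸r≤h : M ∸ r ≤ h
    M∸r≤h = ≤-trans (∸-monoʳ-≤ M (<⇒≤ (≰⇒> r≰h))) (≤-reflexive (m+n∸n≡m h h))
    reflect : ∀ s r → s + r ≡ M → + r ≡ - + s +ℤ + 1 *ℤ + M
    reflect s r s+r≡M = trans (ring (+ s) (+ r)) (cong (λ t → - + s +ℤ + 1 *ℤ t) (cong +_ s+r≡M))
      where
      ring : ∀ s r → r ≡ - s +ℤ + 1 *ℤ (s +ℤ r)
      ring = solve-∀

  ±∼-trans : ∀ {t z z′} → t ±∼ z → z ∼ z′ → t ±∼ z′
  ±∼-trans (inj₁ t∼z)  z∼z′ = inj₁ (∼-trans t∼z z∼z′)
  ±∼-trans (inj₂ -t∼z) z∼z′ = inj₂ (∼-trans -t∼z z∼z′)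

  ‖‖-spec : ∀ z → ‖ z ‖ ≤ h × ‖ z ‖ ±∼ z
  ‖‖-spec z with foldℕ-spec (toℕ (posℤ {h′ + h} z)) (toℕ<n _)
  ... | ‖z‖≤h , ‖z‖±∼r = ‖z‖≤h , ±∼-trans ‖z‖±∼r (toℕ-posℤ∼ z)

  private
    ≤h→sum≥M⇒≡h : ∀ {a b} → a ≤ h → b ≤ h → M ≤ a + b → a ≡ h
    ≤h→sum≥M⇒≡h {a} a≤h b≤h M≤a+b with a <? h
    ... | yes a<h = ⊥-elim (<⇒≱ (+-mono-<-≤ a<h b≤h) M≤a+b)
    ... | no  a≮h = ≤-antisym a≤h (≮⇒≥ a≮h)

    sum∼0⇒≡ : ∀ {t t′} → t ≤ h → t′ ≤ h → + (t + t′) ∼ + 0 → t ≡ t′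
    sum∼0⇒≡ {t} {t′} t≤h t′≤h t+t′∼0 with t + t′ <? M
    ... | yes t+t′<M = trans (m+n≡0⇒m≡0 t t+t′≡0) (sym (m+n≡0⇒n≡0 t t+t′≡0))
      where t+t′≡0 = residue-unique t+t′<M (s≤s z≤n) t+t′∼0
    ... | no  t+t′≮M = trans (≤h→sum≥M⇒≡h t≤h t′≤h (≮⇒≥ t+t′≮M))
                            (sym (≤h→sum≥M⇒≡h t′≤h t≤h (subst (M ≤_) (+-comm t t′) (≮⇒≥ t+t′≮M))))

    +∼-⇒sum∼0 : ∀ {t t′} → + t ∼ - + t′ → + (t + t′) ∼ + 0
    +∼-⇒sum∼0 {t} {t′} t∼-t′ = subst (+ (t + t′) ∼_) (ℤ.+-inverseˡ (+ t′)) (∼-+ʳ (+ t′) t∼-t′)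

    -∼-⇒∼ : ∀ {t t′} → - + t ∼ - + t′ → + t ∼ + t′
    -∼-⇒∼ = subst₂ _∼_ (ℤ.neg-involutive _) (ℤ.neg-involutive _) ∘ ∼-neg

  ‖‖-unique : ∀ {t z} → t ≤ h → t ±∼ z → ‖ z ‖ ≡ t
  ‖‖-unique {t} {z} t≤h t±∼z with ‖‖-spec z
  ... | ‖z‖≤h , ‖z‖±∼z = compare ‖z‖±∼z t±∼z
    where
    compare : ‖ z ‖ ±∼ z → t ±∼ z → ‖ z ‖ ≡ t
    compare (inj₁ a) (inj₁ b) = residue-unique (≤-<-trans ‖z‖≤h h<M) (≤-<-trans t≤h h<M) (∼-trans a (∼-sym b))
    compare (inj₂ a) (inj₂ b) = residue-unique (≤-<-trans ‖z‖≤h h<M) (≤-<-trans t≤h h<M) (-∼-⇒∼ (∼-trans a (∼-sym b)))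
    compare (inj₁ a) (inj₂ b) = sum∼0⇒≡ ‖z‖≤h t≤h (+∼-⇒sum∼0 (∼-trans a (∼-sym b)))
    compare (inj₂ a) (inj₁ b) = sym (sum∼0⇒≡ t≤h ‖z‖≤h (+∼-⇒sum∼0 (∼-trans b (∼-sym a))))

  ‖‖-cong : ∀ {z z′} → z ∼ z′ → ‖ z ‖ ≡ ‖ z′ ‖
  ‖‖-cong z∼z′ = cong (foldℕ ∘ toℕ) (posℤ-cong z∼z′)

  ‖‖-neg : ∀ z → ‖ - z ‖ ≡ ‖ z ‖
  ‖‖-neg z with ‖‖-spec z
  ... | ‖z‖≤h , inj₁ a = ‖‖-unique ‖z‖≤h (inj₂ (∼-neg a))
  ... | ‖z‖≤h , inj₂ a = ‖‖-unique ‖z‖≤h (inj₁ (subst (_∼ - z) (ℤ.neg-involutive _) (∼-neg a)))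

  ‖‖-small : ∀ {t} → t ≤ h → ‖ + t ‖ ≡ t
  ‖‖-small t≤h = ‖‖-unique t≤h (inj₁ (∼-reflexive refl))

  ‖‖-step : ∀ z → suc ‖ z ‖ ≡ ‖ z +ℤ + 1 ‖ ⊎ suc ‖ z +ℤ + 1 ‖ ≡ ‖ z ‖
  ‖‖-step z with ‖‖-spec z
  ... | ‖z‖≤h , inj₁ t∼z  = ascend ‖z‖≤h t∼z
    where
    ascend : ∀ {t} → t ≤ h → + t ∼ z → suc t ≡ ‖ z +ℤ + 1 ‖ ⊎ suc ‖ z +ℤ + 1 ‖ ≡ t
    ascend {t} t≤h t∼z with t <? h
    ... | yes t<h = inj₁ (sym (‖‖-unique t<h (inj₁ (subst (_∼ z +ℤ + 1) (cong +_ (+-comm t 1)) (∼-+ʳ (+ 1) t∼z)))))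
    ... | no  t≮h = inj₂ (trans (cong suc (‖‖-unique (n≤1+n h′) (inj₂ (∼-trans turn (∼-+ʳ (+ 1) t∼z))))) (sym t≡h))
      where
      t≡h : t ≡ h
      t≡h = ≤-antisym t≤h (≮⇒≥ t≮h)
      ring : ∀ H → + 1 +ℤ H +ℤ + 1 ≡ - H +ℤ + 1 *ℤ ((+ 1 +ℤ H) +ℤ (+ 1 +ℤ H))
      ring = solve-∀
      turn : - + h′ ∼ + t +ℤ + 1
      turn = quotient (+ 1) (trans (cong (λ u → + u +ℤ + 1) t≡h) (ring (+ h′)))
  ... | ‖z‖≤h , inj₂ -t∼z = descend ‖z‖≤h -t∼z
    where
    ring : ∀ T → - T ≡ - (+ 1 +ℤ T) +ℤ + 1
    ring = solve-∀
    descend : ∀ {t} → t ≤ h → - + t ∼ z → suc t ≡ ‖ z +ℤ + 1 ‖ ⊎ suc ‖ z +ℤ + 1 ‖ ≡ t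
    descend {zero}  _   0∼z   = inj₁ (sym (‖‖-unique (s≤s z≤n) (inj₁ (∼-+ʳ (+ 1) 0∼z))))
    descend {suc t} t≤h -t∼z′ = inj₂ (cong suc (‖‖-unique (≤-trans (n≤1+n t) t≤h)
                                  (inj₂ (∼-trans (∼-reflexive (ring (+ t))) (∼-+ʳ (+ 1) -t∼z′)))))

  fold : ℤ → Fin (suc h)
  fold z = fromℕ< (s≤s (proj₁ (‖‖-spec z)))

  toℕ-fold : ∀ z → toℕ (fold z) ≡ ‖ z ‖
  toℕ-fold z = toℕ-fromℕ< _

  fold-cong : ∀ {z z′} → z ∼ z′ → fold z ≡ fold z′
  fold-cong {z} {z′} z∼z′ = toℕ-injective (trans (toℕ-fold z) (trans (‖‖-cong z∼z′) (sym (toℕ-fold z′))))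

  fold-neg : ∀ z → fold (- z) ≡ fold z
  fold-neg z = toℕ-injective (trans (toℕ-fold (- z)) (trans (‖‖-neg z) (sym (toℕ-fold z))))

  module _ {n} (G : Graph n) (k : ℤ) where
    private
      g : Fin M → Fin M
      g = rPow (+ 2 *ℤ k +ℤ + 1) ∘ sRefl

      P : Vec (Fin n) M → Set
      P x = IsClosedWalk G x × FixedBy g x

      P? : Decidable P
      P? x = isClosedWalk? G x ×-dec fixedBy? g x

      Q? : Decidable (λ (u : Vec (Fin n) (suc h)) → T (isWalk G u))
      Q? u = T? (isWalk G u)

      halve : Vec (Fin n) M → Vec (Fin n) (suc h)
      halve x = Vec.tabulate (λ j → extend x (k +ℤ + toℕ j))

      unfold : Vec (Fin n) (suc h) → Vec (Fin n) M
      unfold u = Vec.tabulate (λ i → lookup u (fold (+ toℕ i +ℤ - k)))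

      extend-unfold : ∀ u z → extend (unfold u) z ≡ lookup u (fold (z +ℤ - k))
      extend-unfold u z = trans (lookup∘tabulate (λ i → lookup u (fold (+ toℕ i +ℤ - k))) (posℤ z))
                                (cong (lookup u) (fold-cong (∼-+ʳ (- k) (toℕ-posℤ∼ z))))

      mirror : ∀ (x : Vec (Fin n) M) → FixedBy g x → ∀ t → extend x (k +ℤ - t) ≡ extend x (k +ℤ t)
      mirror x fixed t = trans (cong (extend x) (reflect k t))
                               (Equivalence.to (fixedBy-rPow∘sRefl⇔ x (+ 2 *ℤ k +ℤ + 1)) fixed (k +ℤ t))
        where
        reflect : ∀ k t → k +ℤ - t ≡ - (+ 1 +ℤ (k +ℤ t)) +ℤ (+ 2 *ℤ k +ℤ + 1)
        reflect = solve-∀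

      lookup-halve : ∀ x j → lookup (halve x) j ≡ extend x (k +ℤ + toℕ j)
      lookup-halve x = lookup∘tabulate (λ j → extend x (k +ℤ + toℕ j))

      halve-fold : ∀ (x : Vec (Fin n) M) → FixedBy g x → ∀ w → lookup (halve x) (fold w) ≡ extend x (k +ℤ w)
      halve-fold x fixed w with ‖‖-spec w
      ... | _ , ‖w‖±∼w = trans (lookup-halve x (fold w))
                              (trans (cong (λ t → extend x (k +ℤ + t)) (toℕ-fold w)) (unfolded ‖w‖±∼w))
        where
        unfolded : ‖ w ‖ ±∼ w → extend x (k +ℤ + ‖ w ‖) ≡ extend x (k +ℤ w)
        unfolded (inj₁ ‖w‖∼w)  = extend-cong x (∼-+ˡ k ‖w‖∼w)
        unfolded (inj₂ -‖w‖∼w) = trans (sym (mirror x fixed (+ ‖ w ‖))) (extend-cong x (∼-+ˡ k -‖w‖∼w))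

      walk-halve : ∀ x → P x → T (isWalk G (halve x))
      walk-halve x (closed , _) = adjacent⇒isWalk G (halve x) (λ j →
        subst₂ (λ a b → T (adj G a b))
          (sym (trans (lookup-halve x (inject₁ j)) (cong (λ t → extend x (k +ℤ + t)) (toℕ-inject₁ j))))
          (sym (trans (lookup-halve x (suc j)) (cong (extend x) (shift k (+ toℕ j)))))
          (Equivalence.to (isClosedWalk⇔ℤ G x) closed (k +ℤ + toℕ j)))
        where
        shift : ∀ k t → k +ℤ (+ 1 +ℤ t) ≡ k +ℤ t +ℤ + 1
        shift = solve-∀

      walk-fold : ∀ u → T (isWalk G u) → ∀ w → T (adj G (lookup u (fold w)) (lookup u (fold (w +ℤ + 1))))
      walk-fold u walk w with ‖‖-step w
      ... | inj₁ up   = isWalk⇒adjacent G u walk (fold w) (fold (w +ℤ + 1))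
                          (trans (cong suc (toℕ-fold w)) (trans up (sym (toℕ-fold (w +ℤ + 1)))))
      ... | inj₂ down = subst T (symm G (lookup u (fold (w +ℤ + 1))) (lookup u (fold w)))
                          (isWalk⇒adjacent G u walk (fold (w +ℤ + 1)) (fold w)
                            (trans (cong suc (toℕ-fold (w +ℤ + 1))) (trans down (sym (toℕ-fold w)))))

      P-unfold : ∀ u → T (isWalk G u) → P (unfold u)
      P-unfold u walk =
          Equivalence.from (isClosedWalk⇔ℤ G (unfold u)) (isClosedWalkℤ-≗ G (sym ∘ extend-unfold u) (λ z →
            subst (λ w → T (adj G (lookup u (fold (z +ℤ - k))) (lookup u (fold w))))
                  (shift z k) (walk-fold u walk (z +ℤ - k))))
        , Equivalence.from (fixedBy-rPow∘sRefl⇔ (unfold u) (+ 2 *ℤ k +ℤ + 1)) (λ z →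
            trans (extend-unfold u (- (+ 1 +ℤ z) +ℤ (+ 2 *ℤ k +ℤ + 1)))
                  (trans (cong (lookup u) (trans (cong fold (reflect z k)) (fold-neg (z +ℤ - k))))
                         (sym (extend-unfold u z))))
        where
        shift : ∀ z k → z +ℤ - k +ℤ + 1 ≡ z +ℤ + 1 +ℤ - k
        shift = solve-∀
        reflect : ∀ z k → - (+ 1 +ℤ z) +ℤ (+ 2 *ℤ k +ℤ + 1) +ℤ - k ≡ - (z +ℤ - k)
        reflect = solve-∀

      unfold∘halve : ∀ x → P x → unfold (halve x) ≡ x
      unfold∘halve x (_ , fixed) = extend-injective (λ z →
        trans (extend-unfold (halve x) z) (trans (halve-fold x fixed (z +ℤ - k)) (cong (extend x) (cancel k z))))
        where
        cancel : ∀ k z → k +ℤ (z +ℤ - k) ≡ z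
        cancel = solve-∀

      halve∘unfold : ∀ u → T (isWalk G u) → halve (unfold u) ≡ u
      halve∘unfold u _ = trans (tabulate-cong (λ j → trans (extend-unfold u (k +ℤ + toℕ j)) (cong (lookup u) (fold-toℕ j))))
                               (tabulate∘lookup u)
        where
        cancel : ∀ k t → k +ℤ t +ℤ - k ≡ t
        cancel = solve-∀
        fold-toℕ : ∀ j → fold (k +ℤ + toℕ j +ℤ - k) ≡ j
        fold-toℕ j = toℕ-injective (trans (toℕ-fold (k +ℤ + toℕ j +ℤ - k))
                       (trans (cong ‖_‖ (cancel k (+ toℕ j))) (‖‖-small (≤-pred (toℕ<n j)))))

    fixCount-r²ᵏ⁺¹s≡onesForm : fixCount G M (rPow (+ 2 *ℤ k +ℤ + 1) ∘ sRefl) ≡ onesForm (adjMatrix G ^ᴹ h)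
    fixCount-r²ᵏ⁺¹s≡onesForm = begin
      fixCount G M g                  ≡⟨ length-filter-allVecs P? ⟩
      count P?                        ≡⟨ count-bijection P? Q? halve unfold
                                           walk-halve P-unfold unfold∘halve halve∘unfold ⟩
      count Q?                        ≡⟨ onesForm-^ᴹ≡walks G h ⟨
      onesForm (adjMatrix G ^ᴹ h)     ∎
      where open ≡-Reasoning

¬2∣⇒≡1+2*[/2] : ∀ N → ¬ (2 ∣ N) → N ≡ 1 + 2 * (N / 2)
¬2∣⇒≡1+2*[/2] N 2∤N with N % 2 | m%n<n N 2 | m≡m%n+[m/n]*n N 2
... | zero        | _             | N≡[N/2]*2   = ⊥-elim (2∤N (divides (N / 2) N≡[N/2]*2))
... | suc zero    | _             | N≡1+[N/2]*2 = trans N≡1+[N/2]*2 (cong suc (*-comm (N / 2) 2))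
... | suc (suc _) | s≤s (s≤s ()) | _

module _ {n} (G : Graph n) (m : ℕ) (k : ℤ) where

  fixCount-r²ᵏ⁺¹s-2∣N : 2 ∣ suc m →
    fixCount G (suc m) (rPow (+ 2 *ℤ k +ℤ + 1) ∘ sRefl) ≡ onesForm (adjMatrix G ^ᴹ (suc m / 2))
  fixCount-r²ᵏ⁺¹s-2∣N (divides h@(suc h′) N≡h*2) =
    subst (λ N → fixCount G N (rPow (+ 2 *ℤ k +ℤ + 1) ∘ sRefl) ≡ onesForm (adjMatrix G ^ᴹ (N / 2)))
          (sym (trans N≡h*2 h*2≡h+h))
          (trans (Folding.fixCount-r²ᵏ⁺¹s≡onesForm h′ G k)
                 (cong (λ t → onesForm (adjMatrix G ^ᴹ t)) (sym [h+h]/2≡h)))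
    where
    h*2≡h+h : h * 2 ≡ h + h
    h*2≡h+h = trans (*-comm h 2) (cong (_+_ h) (+-identityʳ h))
    [h+h]/2≡h : (h + h) / 2 ≡ h
    [h+h]/2≡h = trans (cong (_/ 2) (sym h*2≡h+h)) (m*n/n≡m h 2)

  fixCount-r²ᵏ⁺¹s-2∤N : ¬ (2 ∣ suc m) → fixCount G (suc m) (rPow (+ 2 *ℤ k +ℤ + 1) ∘ sRefl) ≡ 0
  fixCount-r²ᵏ⁺¹s-2∤N 2∤N = fixCount-r²ᵏ⁺¹s≡0 G m (suc m / 2) (¬2∣⇒≡1+2*[/2] (suc m) 2∤N) k

-- The hypothesis 3 ≤ N is only needed to exclude N = 0.
lemma2p1 : ∀ {n} (G : Graph n) (N : ℕ) → 3 ≤ N →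
    ((k : ℤ) → fixCount G N (rPow k) ≡ tr (adjMatrix G ^ᴹ gcd ∣ k ∣ N))
    × ((k : ℤ) → fixCount G N (rPow ((+ 2) *ℤ k) ∘ sRefl) ≡ 0)
    × ((k : ℤ) →
    (2 ∣ N → fixCount G N (rPow ((+ 2) *ℤ k +ℤ + 1) ∘ sRefl) ≡ onesForm (adjMatrix G ^ᴹ (N / 2)))
    × (¬ (2 ∣ N) → fixCount G N (rPow ((+ 2) *ℤ k +ℤ + 1) ∘ sRefl) ≡ 0))
lemma2p1 G (suc m) _ =
    fixCount-rᵏ-gcd G m
  , fixCount-r²ᵏs G m
  , λ k → fixCount-r²ᵏ⁺¹s-2∣N G m k , fixCount-r²ᵏ⁺¹s-2∤N G m k
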